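{- Fix $k\ge2$. Then $|\mathcal D^{k,0}_{n,m}(0)|=M^{k-1}_{n,m}(\vec0,\vec1)$ for all $n\ge0$ and $0\le m\le n$, where $\vec0=(0,\dots,0)$ and $\vec1=(1,\dots,1)$ are $(k-1)$-tuples.
   Context: For $k\ge2$ and $a\ge0$, $\mathcal D^{k,a}_{n,m}$ is the set of integer lattice paths from $(0,0)$ to $(kn,km)$ using steps $U=(1,1)$ and $D_{k-1}=(1,1-k)$ that stay weakly above the line $y=-a$. A peak of such a path is a subpath $UD_{k-1}$; its height is the $y$-coordinate of the right endpoint of that $U$ step. For $0\le i\le k-1$, $\mathcal D^{k,a}_{n,m}(i)$ is the subset of paths in which the height of every peak is congruent to $i$ modulo $k$ (vacuously true for a path with no peaks). An order-$\ell$ Motzkin path of length $n$ and height $m$ is an integer lattice path from $(0,0)$ to $(n,m)$ using steps $U=(1,1)$ and $D_i=(1,-i)$ for $0\le i\le \ell$, never going below $y=0$. For $\ell$-tuples of non-negative integers $\vec\alpha,\vec\beta$, an $(\vec\alpha,\vec\beta)$-colored Motzkin path is such a path in which, for each $0\le i\le \ell-1$, each $D_i$ step whose right endpoint is at height $0$ is labeled by one of $\alpha_i$ colors and each $D_i$ step whose right endpoint is at height $>0$ is labeled by one of $\beta_i$ colors; $U$ and $D_\ell$ steps are unlabeled. $M^\ell_{n,m}(\vec\alpha,\vec\beta)$ is the number of such colored paths of length $n$ and height $m$. -}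

module Defs where

open import Data.Bool using (Bool; true; false; _∧_; if_then_else_)
open import Data.Nat as ℕ using (ℕ; zero; suc; _∸_)
open import Data.Nat.Divisibility using (_∣?_)
open import Data.Integer as ℤ using (ℤ; +_; -_; ∣_∣)
open import Data.Fin using (Fin; toℕ)
open import Data.List using (List; allFin; []; _∷_; map; concatMap; length; filter)
open import Data.Nat.ListAction using (sum)
open import Relation.Nullary using (does)

words : {S : Set} → List S → ℕ → List (List S)
words alph zero    = [] ∷ []
words alph (suc n) = concatMap (λ s → map (s ∷_) (words alph n)) alph

-- Paths with steps U = (1,1) and D_{k-1} = (1,1-k)

data KStep : Set where
  U D : KStep

kAlphabet : List KStep
kAlphabet = U ∷ D ∷ []

δ : ℕ → KStep → ℤ
δ k U = + 1
δ k D = + 1 ℤ.- + k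

staysAbove : ℕ → ℕ → ℤ → List KStep → Bool
staysAbove k a h []      = true
staysAbove k a h (s ∷ w) = ((- + a) ℤ.≤ᵇ (h ℤ.+ δ k s)) ∧ staysAbove k a (h ℤ.+ δ k s) w

endHeight : ℕ → ℤ → List KStep → ℤ
endHeight k h []      = h
endHeight k h (s ∷ w) = endHeight k (h ℤ.+ δ k s) w

congMod : ℕ → ℤ → ℕ → Bool
congMod k x i = does (k ∣? ∣ x ℤ.- + i ∣)

peaksOK : ℕ → ℕ → ℤ → List KStep → Bool
peaksOK k i h []           = true
peaksOK k i h (U ∷ D ∷ w)  = congMod k (h ℤ.+ + 1) i ∧ peaksOK k i (h ℤ.+ + 1) (D ∷ w)
peaksOK k i h (U ∷ U ∷ w)  = peaksOK k i (h ℤ.+ + 1) (U ∷ w)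
peaksOK k i h (U ∷ [])     = true
peaksOK k i h (D ∷ w)      = peaksOK k i (h ℤ.+ δ k D) w

inDki : ℕ → ℕ → ℕ → ℕ → List KStep → Bool
inDki k a m i w =
  staysAbove k a (+ 0) w ∧
  does (endHeight k (+ 0) w ℤ.≟ + (k ℕ.* m)) ∧
  peaksOK k i (+ 0) w

cardD : (k a n m i : ℕ) → ℕ
cardD k a n m i = length (filter (λ w → Data.Bool._≟_ (inDki k a m i w) true)
                                 (words kAlphabet (k ℕ.* n)))
  where import Data.Bool

-- Order-ℓ Motzkin paths: steps U, D_i (i < ℓ, colored), D_ℓ (uncolored)

data MStep (ℓ : ℕ) : Set where
  mU  : MStep ℓ
  mD  : Fin ℓ → MStep ℓ
  mDℓ : MStep ℓ

mAlphabet : (ℓ : ℕ) → List (MStep ℓ)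
mAlphabet ℓ = mU ∷ mDℓ ∷ map mD (allFin ℓ)

-- number of colorings of the path given by the word (0 if the word
-- goes below y = 0 or does not end at height m), starting at height h
colorings : (ℓ : ℕ) → (Fin ℓ → ℕ) → (Fin ℓ → ℕ) → ℕ → ℕ → List (MStep ℓ) → ℕ
colorings ℓ α β m h []          = if h ℕ.≡ᵇ m then 1 else 0
colorings ℓ α β m h (mU ∷ w)    = colorings ℓ α β m (suc h) w
colorings ℓ α β m h (mD i ∷ w)  =
  if toℕ i ℕ.≤ᵇ h
  then (if (h ∸ toℕ i) ℕ.≡ᵇ 0 then α i else β i) ℕ.* colorings ℓ α β m (h ∸ toℕ i) w
  else 0
colorings ℓ α β m h (mDℓ ∷ w)   =
  if ℓ ℕ.≤ᵇ h then colorings ℓ α β m (h ∸ ℓ) w else 0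

M : (ℓ n m : ℕ) → (α β : Fin ℓ → ℕ) → ℕ
M ℓ n m α β = sum (map (colorings ℓ α β m 0) (words (mAlphabet ℓ) n))

module Submission where

-- A step U or D_{k-1} changes the height by 1 modulo k, so after every k steps a path sits at a
-- multiple of k, and it is cut into blocks of k steps. In a path of D^{k,0}(0) a D step may only
-- follow a U step that ends at a height divisible by k, so each block reads D^a U^(k-a) with
-- 0 ≤ a ≤ k, and taking block heights divided by k it becomes a Motzkin step: U for a = 0,
-- D_(a-1) for 0 < a < k and D_(k-1) for a = k. The block stays above 0 exactly when a D_i step with
-- i < k - 1 ends strictly above 0 and a D_(k-1) step ends at height ≥ 0, which are the weights
-- α = 0, β = 1. Both counts therefore satisfy the same recursion in n, obtained by splitting off
-- the first block, respectively the first Motzkin step.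

open import Defs
open import Data.Nat using (ℕ; _≤_; _∸_)
open import Relation.Binary.PropositionalEquality using (_≡_)

open import Data.Bool using (T; Bool; true; false; not; _∧_; _∨_; if_then_else_)
import Data.Bool as Bool
open import Data.Bool.Properties using (∧-identityʳ; ∧-zeroʳ; ∨-zeroʳ; ∨-identityʳ)
open import Data.Fin using (Fin; toℕ)
open import Data.Integer as ℤ using (+_)
open import Data.List using (List; []; _∷_; _++_; map; concatMap; applyUpTo; tabulate; allFin; filter; length)
open import Data.List.Properties using (map-++; map-∘; map-cong; map-tabulate; tabulate-cong)
open import Data.Nat using (zero; suc; _+_; _*_; _<_; z<s; s≤s; z≤n; NonZero; _≤ᵇ_; _<ᵇ_; _≡ᵇ_)
open import Data.Nat.Divisibility using (_∣_; _∣?_; ∣m+n∣m⇒∣n; m∣m*n; ∣⇒≤)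
open import Data.Nat.ListAction using (sum)
open import Data.Nat.ListAction.Properties using (sum-++)
open import Data.Nat.Properties using (_≟_; _<?_; _≤?_; ≤⇒≯; <⇒≱; <ᵇ⇒<; m≤m+n; m<m+n; +-monoʳ-≤; m+n∸m≡n; m<n⇒0<n∸m; +-identityʳ; +-comm; +-assoc; +-suc; *-zeroʳ; *-suc; *-distribˡ-+; *-cancelˡ-≡)
open import Data.Nat.Tactic.RingSolver using (solve-∀)
open import Data.Unit using (tt)
open import Function using (_∘_)
open import Relation.Binary.PropositionalEquality using (refl; sym; trans; cong; cong₂; subst; _≗_; module ≡-Reasoning)
open import Relation.Nullary using (¬_; yes; no)
open import Relation.Nullary.Decidable using (does; dec-true; dec-false)

count : {A : Set} → (A → Bool) → List A → ℕ
count p xs = sum (map (λ x → if p x then 1 else 0) xs)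

length-filter≡count : {A : Set} (p : A → Bool) (xs : List A) →
  length (filter (λ x → p x Bool.≟ true) xs) ≡ count p xs
length-filter≡count p [] = refl
length-filter≡count p (x ∷ xs) with p x
... | true  = cong suc (length-filter≡count p xs)
... | false = length-filter≡count p xs

sum-map-zero : {A : Set} (xs : List A) → sum (map (λ _ → 0) xs) ≡ 0
sum-map-zero []       = refl
sum-map-zero (_ ∷ xs) = sum-map-zero xs

sum-map-if : {A : Set} (b : Bool) (g : A → ℕ) (xs : List A) →
  sum (map (λ x → if b then g x else 0) xs) ≡ (if b then sum (map g xs) else 0)
sum-map-if true  g xs = refl
sum-map-if false g xs = sum-map-zero xs

sum-map-*ˡ : {A : Set} (c : ℕ) (g : A → ℕ) (xs : List A) →
  sum (map (λ x → c * g x) xs) ≡ c * sum (map g xs)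
sum-map-*ˡ c g []       = sym (*-zeroʳ c)
sum-map-*ˡ c g (x ∷ xs) =
  trans (cong (λ s → c * g x + s) (sum-map-*ˡ c g xs)) (sym (*-distribˡ-+ c (g x) _))

sum-map-concatMap : {A B : Set} (F : B → ℕ) (g : A → List B) (xs : List A) →
  sum (map F (concatMap g xs)) ≡ sum (map (λ x → sum (map F (g x))) xs)
sum-map-concatMap F g []       = refl
sum-map-concatMap F g (x ∷ xs) = begin
  sum (map F (g x ++ concatMap g xs))               ≡⟨ cong sum (map-++ F (g x) _) ⟩
  sum (map F (g x) ++ map F (concatMap g xs))        ≡⟨ sum-++ (map F (g x)) _ ⟩
  sum (map F (g x)) + sum (map F (concatMap g xs))   ≡⟨ cong (λ s → sum (map F (g x)) + s) (sum-map-concatMap F g xs) ⟩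
  sum (map F (g x)) + sum (map (λ y → sum (map F (g y))) xs) ∎
  where open ≡-Reasoning

sum-map-words-suc : {S : Set} (F : List S → ℕ) (A : List S) (n : ℕ) →
  sum (map F (words A (suc n))) ≡ sum (map (λ s → sum (map (λ w → F (s ∷ w)) (words A n))) A)
sum-map-words-suc F A n =
  trans (sum-map-concatMap F _ A) (cong sum (map-cong (λ s → cong sum (sym (map-∘ (words A n)))) A))

sum-applyUpTo-cong : {g h : ℕ → ℕ} → g ≗ h → (n : ℕ) → sum (applyUpTo g n) ≡ sum (applyUpTo h n)
sum-applyUpTo-cong g≗h zero    = refl
sum-applyUpTo-cong g≗h (suc n) = cong₂ _+_ (g≗h 0) (sum-applyUpTo-cong (g≗h ∘ suc) n)

sum-applyUpTo-zero : {g : ℕ → ℕ} → (∀ i → g i ≡ 0) → (n : ℕ) → sum (applyUpTo g n) ≡ 0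
sum-applyUpTo-zero g≡0 zero    = refl
sum-applyUpTo-zero g≡0 (suc n) = cong₂ _+_ (g≡0 0) (sum-applyUpTo-zero (g≡0 ∘ suc) n)

tabulate-∘toℕ : {A : Set} (n : ℕ) (g : ℕ → A) → tabulate {n = n} (g ∘ toℕ) ≡ applyUpTo g n
tabulate-∘toℕ zero    g = refl
tabulate-∘toℕ (suc n) g = cong (g 0 ∷_) (tabulate-∘toℕ n (g ∘ suc))

<ᵇ-true : ∀ {m n} → m < n → (m <ᵇ n) ≡ true
<ᵇ-true {m} {n} = dec-true (m <? n)

<ᵇ-false : ∀ {m n} → n ≤ m → (m <ᵇ n) ≡ false
<ᵇ-false {m} {n} n≤m = dec-false (m <? n) (≤⇒≯ n≤m)

≤ᵇ-true : ∀ {m n} → m ≤ n → (m ≤ᵇ n) ≡ true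
≤ᵇ-true {m} {n} = dec-true (m ≤? n)

≤ᵇ-false : ∀ {m n} → n < m → (m ≤ᵇ n) ≡ false
≤ᵇ-false {m} {n} n<m = dec-false (m ≤? n) (<⇒≱ n<m)

+0≤ᵇm⊖n : ∀ m n → (+ 0 ℤ.≤ᵇ m ℤ.⊖ n) ≡ not (m <ᵇ n)
+0≤ᵇm⊖n m n with m <ᵇ n in m<n
... | false = refl
... | true with n ∸ m | m<n⇒0<n∸m (<ᵇ⇒< m n (subst T (sym m<n) tt))
...   | suc _ | _ = refl

*-cancelˡ-≡ᵇ : ∀ k .{{_ : NonZero k}} m n → (k * m ≡ᵇ k * n) ≡ (m ≡ᵇ n)
*-cancelˡ-≡ᵇ k m n with m ≟ n
... | yes refl = trans (dec-true (k * m ≟ k * m) refl) (sym (dec-true (m ≟ m) refl))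
... | no m≢n   = trans (dec-false (k * m ≟ k * n) (m≢n ∘ *-cancelˡ-≡ m n k)) (sym (dec-false (m ≟ n) m≢n))

a+[1+ℓ]*[1+G]≡ℓ+[1+a+[1+ℓ]*G] : ∀ ℓ a G → a + suc ℓ * suc G ≡ ℓ + (suc a + suc ℓ * G)
a+[1+ℓ]*[1+G]≡ℓ+[1+a+[1+ℓ]*G] = solve-∀

∤-suc+* : ∀ {k} p G → suc p < k → ¬ (k ∣ suc p + k * G)
∤-suc+* {k} p G p<k k∣ =
  <⇒≱ p<k (∣⇒≤ (∣m+n∣m⇒∣n (subst (k ∣_) (+-comm (suc p) (k * G)) k∣) (m∣m*n G)))

module Motzkin (ℓ : ℕ) (α β : Fin ℓ → ℕ) where

  stepWeight : (ℕ → ℕ) → ℕ → MStep ℓ → ℕ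
  stepWeight f h mU     = f (suc h)
  stepWeight f h (mD i) = if toℕ i ≤ᵇ h then (if h ∸ toℕ i ≡ᵇ 0 then α i else β i) * f (h ∸ toℕ i) else 0
  stepWeight f h mDℓ    = if ℓ ≤ᵇ h then f (h ∸ ℓ) else 0

  motzkinStep : (ℕ → ℕ) → ℕ → ℕ
  motzkinStep f h = sum (map (stepWeight f h) (mAlphabet ℓ))

  stepWeight-cong : {f g : ℕ → ℕ} → f ≗ g → ∀ h s → stepWeight f h s ≡ stepWeight g h s
  stepWeight-cong f≗g h mU     = f≗g (suc h)
  stepWeight-cong f≗g h (mD i) =
    cong (λ z → if toℕ i ≤ᵇ h then (if h ∸ toℕ i ≡ᵇ 0 then α i else β i) * z else 0) (f≗g (h ∸ toℕ i))
  stepWeight-cong f≗g h mDℓ    = cong (λ z → if ℓ ≤ᵇ h then z else 0) (f≗g (h ∸ ℓ))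

  motzkinStep-cong : {f g : ℕ → ℕ} → f ≗ g → ∀ h → motzkinStep f h ≡ motzkinStep g h
  motzkinStep-cong f≗g h = cong sum (map-cong (stepWeight-cong f≗g h) (mAlphabet ℓ))

  sum-stepWeight : {A : Set} (F : A → ℕ → ℕ) (xs : List A) (h : ℕ) (s : MStep ℓ) →
    sum (map (λ x → stepWeight (F x) h s) xs) ≡ stepWeight (λ h′ → sum (map (λ x → F x h′) xs)) h s
  sum-stepWeight F xs h mU     = refl
  sum-stepWeight F xs h (mD i) =
    trans (sum-map-if (toℕ i ≤ᵇ h) _ xs)
          (cong (λ z → if toℕ i ≤ᵇ h then z else 0) (sum-map-*ˡ (if h ∸ toℕ i ≡ᵇ 0 then α i else β i) (λ x → F x (h ∸ toℕ i)) xs))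
  sum-stepWeight F xs h mDℓ    = sum-map-if (ℓ ≤ᵇ h) _ xs

  colorings-∷ : ∀ m h s w → colorings ℓ α β m h (s ∷ w) ≡ stepWeight (λ h′ → colorings ℓ α β m h′ w) h s
  colorings-∷ m h mU     w = refl
  colorings-∷ m h (mD i) w = refl
  colorings-∷ m h mDℓ    w = refl

  motzkin : (m n h : ℕ) → ℕ
  motzkin m n h = sum (map (colorings ℓ α β m h) (words (mAlphabet ℓ) n))

  motzkin-suc : ∀ m n h → motzkin m (suc n) h ≡ motzkinStep (motzkin m n) h
  motzkin-suc m n h = begin
    motzkin m (suc n) h
      ≡⟨ sum-map-words-suc (colorings ℓ α β m h) (mAlphabet ℓ) n ⟩
    sum (map (λ s → sum (map (λ w → colorings ℓ α β m h (s ∷ w)) W)) (mAlphabet ℓ))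
      ≡⟨ cong sum (map-cong (λ s → trans (cong sum (map-cong (colorings-∷ m h s) W))
                                          (sum-stepWeight (λ w h′ → colorings ℓ α β m h′ w) W h s))
                            (mAlphabet ℓ)) ⟩
    motzkinStep (motzkin m n) h ∎
    where
    open ≡-Reasoning
    W = words (mAlphabet ℓ) n

weightDᵢ : (ℕ → ℕ) → ℕ → ℕ → ℕ
weightDᵢ f h i = if i <ᵇ h then f (h ∸ i) else 0

weightDₗ : ℕ → (ℕ → ℕ) → ℕ → ℕ
weightDₗ ℓ f h = if ℓ ≤ᵇ h then f (h ∸ ℓ) else 0

weightDᵢ-≥ : ∀ f {h i} → h ≤ i → weightDᵢ f h i ≡ 0
weightDᵢ-≥ f h≤i rewrite <ᵇ-false h≤i = refl

weightDᵢ-+ : ∀ f i h → weightDᵢ f (i + suc h) i ≡ f (suc h)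
weightDᵢ-+ f i h rewrite <ᵇ-true (m<m+n i {suc h} z<s) | m+n∸m≡n i (suc h) = refl

weightDₗ-< : ∀ ℓ f {h} → h < ℓ → weightDₗ ℓ f h ≡ 0
weightDₗ-< ℓ f h<ℓ rewrite ≤ᵇ-false h<ℓ = refl

weightDₗ-+ : ∀ ℓ f h → weightDₗ ℓ f (ℓ + h) ≡ f h
weightDₗ-+ ℓ f h rewrite ≤ᵇ-true (m≤m+n ℓ h) | m+n∸m≡n ℓ h = refl

stepWeight₀₁ : ∀ f h i →
  (if i ≤ᵇ h then (if h ∸ i ≡ᵇ 0 then 0 else 1) * f (h ∸ i) else 0) ≡ weightDᵢ f h i
stepWeight₀₁ f zero    zero          = refl
stepWeight₀₁ f (suc h) zero          = +-identityʳ (f (suc h))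
stepWeight₀₁ f zero    (suc i)       = refl
stepWeight₀₁ f (suc h) (suc zero)    = stepWeight₀₁ f h zero
stepWeight₀₁ f (suc h) (suc (suc i)) = stepWeight₀₁ f h (suc i)

motzkinStep₀₁ : ∀ ℓ f h → Motzkin.motzkinStep ℓ (λ _ → 0) (λ _ → 1) f h
                          ≡ f (suc h) + (weightDₗ ℓ f h + sum (applyUpTo (weightDᵢ f h) ℓ))
motzkinStep₀₁ ℓ f h = cong (λ z → f (suc h) + (weightDₗ ℓ f h + sum z)) (begin
  map (stepWeight f h) (map mD (allFin ℓ))  ≡⟨ sym (map-∘ (allFin ℓ)) ⟩
  map (stepWeight f h ∘ mD) (allFin ℓ)      ≡⟨ map-tabulate (λ i → i) (stepWeight f h ∘ mD) ⟩
  tabulate (stepWeight f h ∘ mD)            ≡⟨ tabulate-cong (stepWeight₀₁ f h ∘ toℕ) ⟩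
  tabulate (weightDᵢ f h ∘ toℕ)             ≡⟨ tabulate-∘toℕ ℓ (weightDᵢ f h) ⟩
  applyUpTo (weightDᵢ f h) ℓ                ∎)
  where
  open ≡-Reasoning
  open Motzkin ℓ (λ _ → 0) (λ _ → 1)

module PeakPaths (j m : ℕ) where

  ℓ k : ℕ
  ℓ = suc j
  k = suc ℓ

  divisible : ℕ → Bool
  divisible y = does (k ∣? y)

  -- The flag says whether a D step may come next: right after a U step ending at a height not
  -- divisible by k it may not, since that would create a forbidden peak.
  valid : ℕ → Bool → List KStep → Bool
  valid x c     []      = x ≡ᵇ k * m
  valid x c     (U ∷ w) = valid (suc x) (divisible (suc x)) w
  valid x false (D ∷ w) = false
  valid x true  (D ∷ w) = if x <ᵇ ℓ then false else valid (x ∸ ℓ) true w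

  opensWithD : List KStep → Bool
  opensWithD []      = false
  opensWithD (U ∷ _) = false
  opensWithD (D ∷ _) = true

  peaksOK-U : ∀ x w →
    peaksOK k 0 (+ x) (U ∷ w) ≡ (divisible (suc x) ∨ not (opensWithD w)) ∧ peaksOK k 0 (+ suc x) w
  peaksOK-U x []      = sym (cong (_∧ true) (∨-zeroʳ (divisible (suc x))))
  peaksOK-U x (U ∷ w) rewrite ∨-zeroʳ (divisible (suc x)) | +-comm x 1 = refl
  peaksOK-U x (D ∷ w) rewrite ∨-identityʳ (divisible (suc x)) | +-identityʳ (x + 1) | +-comm x 1 = refl

  valid-correct : ∀ x c w →
    staysAbove k 0 (+ x) w ∧ (does (endHeight k (+ x) w ℤ.≟ + (k * m))
      ∧ ((c ∨ not (opensWithD w)) ∧ peaksOK k 0 (+ x) w))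
    ≡ valid x c w
  valid-correct x true  []      = ∧-identityʳ (x ≡ᵇ k * m)
  valid-correct x false []      = ∧-identityʳ (x ≡ᵇ k * m)
  valid-correct x c     (U ∷ w) rewrite ∨-zeroʳ c | peaksOK-U x w | +-comm x 1 =
    valid-correct (suc x) (divisible (suc x)) w
  valid-correct x false (D ∷ w) = trans (cong (above ∧_) (∧-zeroʳ ends)) (∧-zeroʳ above)
    where
    above = staysAbove k 0 (+ x) (D ∷ w)
    ends  = does (endHeight k (+ x) (D ∷ w) ℤ.≟ + (k * m))
  valid-correct x true  (D ∷ w) rewrite +0≤ᵇm⊖n x ℓ with x <ᵇ ℓ
  ... | true  = refl
  ... | false = valid-correct (x ∸ ℓ) true w

  paths : ℕ → ℕ → Bool → ℕ
  paths N x c = count (valid x c) (words kAlphabet N)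

  descendFrom : ℕ → ℕ → ℕ
  descendFrom N x = if x <ᵇ ℓ then 0 else paths N (x ∸ ℓ) true

  paths-suc : ∀ N x → paths (suc N) x true ≡ paths N (suc x) (divisible (suc x)) + descendFrom N x
  paths-suc N x =
    trans (sum-map-words-suc _ kAlphabet N)
          (cong (λ z → paths N (suc x) (divisible (suc x)) + z) (trans (+-identityʳ _) afterD))
    where
    afterD : sum (map (λ w → if valid x true (D ∷ w) then 1 else 0) (words kAlphabet N)) ≡ descendFrom N x
    afterD with x <ᵇ ℓ
    ... | true  = sum-map-zero (words kAlphabet N)
    ... | false = refl

  paths-suc-blocked : ∀ N x → paths (suc N) x false ≡ paths N (suc x) (divisible (suc x))
  paths-suc-blocked N x =
    trans (sum-map-words-suc _ kAlphabet N)
          (trans (cong (λ z → paths N (suc x) (divisible (suc x)) + (z + 0)) (sum-map-zero (words kAlphabet N)))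
                 (+-identityʳ _))

  descendFrom-< : ∀ N x → x < ℓ → descendFrom N x ≡ 0
  descendFrom-< N x x<ℓ rewrite <ᵇ-true x<ℓ = refl

  descendFrom-ℓ+ : ∀ N y → descendFrom N (ℓ + y) ≡ paths N y true
  descendFrom-ℓ+ N y rewrite <ᵇ-false (m≤m+n ℓ y) | m+n∸m≡n ℓ y = refl

  module _ (N : ℕ) where

    fromLevel : ℕ → ℕ
    fromLevel h = paths N (k * h) true

    climb : ∀ p r G → p + r ≡ ℓ →
      paths (r + N) (suc p + k * G) (divisible (suc p + k * G)) ≡ fromLevel (suc G)
    climb p zero G p+0≡ℓ with trans (sym (+-identityʳ p)) p+0≡ℓ
    ... | refl = trans (cong (λ y → paths N y (divisible y)) (sym (*-suc k G)))
                       (cong (paths N (k * suc G)) (dec-true (k ∣? k * suc G) (m∣m*n (suc G))))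
    climb p (suc r) G p+r≡ℓ = begin
      paths (suc r + N) y (divisible y)
        ≡⟨ cong (paths (suc r + N) y) (dec-false (k ∣? y) (∤-suc+* p G (s≤s p<ℓ))) ⟩
      paths (suc (r + N)) y false
        ≡⟨ paths-suc-blocked (r + N) y ⟩
      paths (r + N) (suc y) (divisible (suc y))
        ≡⟨ climb (suc p) r G (trans (sym (+-suc p r)) p+r≡ℓ) ⟩
      fromLevel (suc G) ∎
      where
      open ≡-Reasoning
      y = suc p + k * G
      p<ℓ : p < ℓ
      p<ℓ = subst (p <_) p+r≡ℓ (m<m+n p z<s)

    -- Height a + k G is where a D steps from the level k (a + G) lead, with r steps of the block left.
    descent : ∀ a r G → a + r ≡ ℓ →
      descendFrom (r + N) (a + k * G)
        ≡ sum (applyUpTo (λ t → weightDᵢ fromLevel (a + G) (a + t)) r) + weightDₗ ℓ fromLevel (a + G)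
    descent a zero G a+0≡ℓ with trans (sym (+-identityʳ a)) a+0≡ℓ
    ... | refl = trans (descendFrom-ℓ+ N (k * G)) (sym (weightDₗ-+ ℓ fromLevel G))
    descent a (suc r) zero a+r≡ℓ = begin
      descendFrom (suc r + N) (a + k * 0)
        ≡⟨ cong (λ x → descendFrom (suc r + N) (a + x)) (*-zeroʳ k) ⟩
      descendFrom (suc r + N) (a + 0)
        ≡⟨ descendFrom-< (suc r + N) (a + 0) a+0<ℓ ⟩
      0
        ≡⟨ sym (cong₂ _+_ (sum-applyUpTo-zero (λ t → weightDᵢ-≥ fromLevel (+-monoʳ-≤ a (z≤n {t}))) (suc r))
                          (weightDₗ-< ℓ fromLevel a+0<ℓ)) ⟩
      sum (applyUpTo (λ t → weightDᵢ fromLevel (a + 0) (a + t)) (suc r)) + weightDₗ ℓ fromLevel (a + 0) ∎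
      where
      open ≡-Reasoning
      a+0<ℓ : a + 0 < ℓ
      a+0<ℓ = subst (_< ℓ) (sym (+-identityʳ a)) (subst (a <_) a+r≡ℓ (m<m+n a z<s))
    descent a (suc r) (suc G) a+r≡ℓ = begin
      descendFrom (suc r + N) (a + k * suc G)
        ≡⟨ cong (descendFrom (suc r + N)) (a+[1+ℓ]*[1+G]≡ℓ+[1+a+[1+ℓ]*G] ℓ a G) ⟩
      descendFrom (suc r + N) (ℓ + y)
        ≡⟨ descendFrom-ℓ+ (suc r + N) y ⟩
      paths (suc (r + N)) y true
        ≡⟨ paths-suc (r + N) y ⟩
      paths (r + N) (suc y) (divisible (suc y)) + descendFrom (r + N) y
        ≡⟨ cong₂ _+_ (climb (suc a) r G a+r≡ℓ′) (descent (suc a) r G a+r≡ℓ′) ⟩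
      fromLevel (suc G) + (sum (applyUpTo (λ t → weightDᵢ fromLevel (suc a + G) (suc a + t)) r)
                           + weightDₗ ℓ fromLevel (suc a + G))
        ≡⟨ cong₂ (λ x z → fromLevel (suc G) + (x + z)) shift (cong (weightDₗ ℓ fromLevel) (sym (+-suc a G))) ⟩
      fromLevel (suc G) + (rest + weightDₗ ℓ fromLevel H)
        ≡⟨ sym (+-assoc (fromLevel (suc G)) rest _) ⟩
      fromLevel (suc G) + rest + weightDₗ ℓ fromLevel H
        ≡⟨ cong (λ z → z + rest + weightDₗ ℓ fromLevel H) (sym first) ⟩
      sum (applyUpTo (λ t → weightDᵢ fromLevel H (a + t)) (suc r)) + weightDₗ ℓ fromLevel H ∎
      where
      open ≡-Reasoning
      y = suc a + k * G
      H = a + suc G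
      rest = sum (applyUpTo (λ t → weightDᵢ fromLevel H (a + suc t)) r)
      a+r≡ℓ′ : suc a + r ≡ ℓ
      a+r≡ℓ′ = trans (sym (+-suc a r)) a+r≡ℓ
      shift : sum (applyUpTo (λ t → weightDᵢ fromLevel (suc a + G) (suc a + t)) r) ≡ rest
      shift = sum-applyUpTo-cong (λ t → sym (cong₂ (weightDᵢ fromLevel) (+-suc a G) (+-suc a t))) r
      first : weightDᵢ fromLevel H (a + 0) ≡ fromLevel (suc G)
      first = trans (cong (weightDᵢ fromLevel H) (+-identityʳ a)) (weightDᵢ-+ fromLevel a G)

    block : ∀ H → paths (k + N) (k * H) true
                  ≡ fromLevel (suc H) + (weightDₗ ℓ fromLevel H + sum (applyUpTo (weightDᵢ fromLevel H) ℓ))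
    block H = begin
      paths (suc (ℓ + N)) (k * H) true
        ≡⟨ paths-suc (ℓ + N) (k * H) ⟩
      paths (ℓ + N) (suc (k * H)) (divisible (suc (k * H))) + descendFrom (ℓ + N) (k * H)
        ≡⟨ cong₂ _+_ (climb 0 ℓ H refl) (descent 0 ℓ H refl) ⟩
      fromLevel (suc H) + (sum (applyUpTo (weightDᵢ fromLevel H) ℓ) + weightDₗ ℓ fromLevel H)
        ≡⟨ cong (λ z → fromLevel (suc H) + z) (+-comm _ (weightDₗ ℓ fromLevel H)) ⟩
      fromLevel (suc H) + (weightDₗ ℓ fromLevel H + sum (applyUpTo (weightDᵢ fromLevel H) ℓ)) ∎
      where open ≡-Reasoning

  open Motzkin ℓ (λ _ → 0) (λ _ → 1)

  paths≡motzkin : ∀ n H → paths (k * n) (k * H) true ≡ motzkin m n H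
  paths≡motzkin zero H = begin
    paths (k * 0) (k * H) true
      ≡⟨ cong (λ N → paths N (k * H) true) (*-zeroʳ k) ⟩
    (if k * H ≡ᵇ k * m then 1 else 0) + 0
      ≡⟨ cong (λ b → (if b then 1 else 0) + 0) (*-cancelˡ-≡ᵇ k H m) ⟩
    motzkin m 0 H ∎
    where open ≡-Reasoning
  paths≡motzkin (suc n) H = begin
    paths (k * suc n) (k * H) true
      ≡⟨ cong (λ N → paths N (k * H) true) (*-suc k n) ⟩
    paths (k + k * n) (k * H) true
      ≡⟨ block (k * n) H ⟩
    f (suc H) + (weightDₗ ℓ f H + sum (applyUpTo (weightDᵢ f H) ℓ))
      ≡⟨ sym (motzkinStep₀₁ ℓ f H) ⟩
    motzkinStep f H
      ≡⟨ motzkinStep-cong (paths≡motzkin n) H ⟩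
    motzkinStep (motzkin m n) H
      ≡⟨ sym (motzkin-suc m n H) ⟩
    motzkin m (suc n) H ∎
    where
    open ≡-Reasoning
    f = fromLevel (k * n)

corollary3p9 : (k : ℕ) → 2 ≤ k → (n m : ℕ) → m ≤ n →
    cardD k 0 n m 0 ≡ M (k ∸ 1) n m (λ _ → 0) (λ _ → 1)
corollary3p9 (suc (suc j)) (s≤s (s≤s z≤n)) n m _ = begin
  cardD k 0 n m 0
    ≡⟨ length-filter≡count (inDki k 0 m 0) (words kAlphabet (k * n)) ⟩
  count (inDki k 0 m 0) (words kAlphabet (k * n))
    ≡⟨ cong sum (map-cong (λ w → cong (λ b → if b then 1 else 0) (valid-correct 0 true w)) (words kAlphabet (k * n))) ⟩
  paths (k * n) 0 true
    ≡⟨ cong (λ x → paths (k * n) x true) (sym (*-zeroʳ k)) ⟩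
  paths (k * n) (k * 0) true
    ≡⟨ paths≡motzkin n 0 ⟩
  M ℓ n m (λ _ → 0) (λ _ → 1) ∎
  where
  open ≡-Reasoning
  open PeakPaths j m
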